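{- Let $A$ be a DRL-algebra. Then for all $x,y\in A$: (1) $[(x\vee c)\ast(y\vee c)]\vee c=(x\ast y)\vee c$; (2) $\sim((x\vee c)\ast(\sim(\sim y\vee c)))\wedge\sim((y\vee c)\ast(\sim(\sim x\vee c)))=\sim(x\ast y)\vee c$.
   Context: A DRL-algebra (c-differential residuated lattice) is a structure $\langle A,\vee,\wedge,\ast,\sim,c,0,1\rangle$ such that, with $x\Rightarrow y:=\sim(x\ast(\sim y))$, $\langle A,\vee,\wedge,\ast,\Rightarrow,0,1\rangle$ is an integral commutative residuated lattice (lattice with bottom $0$ and top $1$, $\ast$ commutative monoid with unit $1$, $x\ast y\le z$ iff $x\le y\Rightarrow z$), $\sim$ is an involutive dual lattice automorphism, $\sim c=c$, and the Leibniz condition $(x\ast y)\wedge c=((x\wedge c)\ast y)\vee(x\ast(y\wedge c))$ holds. -}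

module Defs where

open import Level using (Level; suc; _⊔_)
open import Relation.Binary.PropositionalEquality using (_≡_)
open import Data.Product using (_×_)
open import Function using (_⇔_)
open import Algebra.Lattice.Structures using (IsLattice)
open import Algebra.Structures using (IsCommutativeMonoid)

-- A DRL-algebra (c-differential residuated lattice), with equality taken to be
-- propositional equality on the carrier.
record DRLAlgebra (a : Level) : Set (suc a) where
  infixr 7 _*_
  infixr 6 _∧_
  infixr 5 _∨_
  infixr 4.5 _⇒_
  infix 4 _≤_
  field
    Carrier : Set a
    _∨_ : Carrier → Carrier → Carrier
    _∧_ : Carrier → Carrier → Carrier
    _*_ : Carrier → Carrier → Carrier
    ∼_  : Carrier → Carrier
    c   : Carrier
    𝟘   : Carrier
    𝟙   : Carrier

  _⇒_ : Carrier → Carrier → Carrier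
  x ⇒ y = ∼ (x * (∼ y))

  _≤_ : Carrier → Carrier → Set a
  x ≤ y = x ∧ y ≡ x

  field
    isLattice : IsLattice _≡_ _∨_ _∧_
    bottom : ∀ x → 𝟘 ≤ x
    top    : ∀ x → x ≤ 𝟙
    isCommutativeMonoid : IsCommutativeMonoid _≡_ _*_ 𝟙
    residuation : ∀ x y z → (x * y ≤ z) ⇔ (x ≤ (y ⇒ z))
    ∼-involutive : ∀ x → ∼ (∼ x) ≡ x
    ∼-∨ : ∀ x y → ∼ (x ∨ y) ≡ (∼ x) ∧ (∼ y)
    ∼-∧ : ∀ x y → ∼ (x ∧ y) ≡ (∼ x) ∨ (∼ y)
    ∼-c : ∼ c ≡ c
    leibniz : ∀ x y → (x * y) ∧ c ≡ ((x ∧ c) * y) ∨ (x * (y ∧ c))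

-- In an integral residuated lattice multiplication distributes over joins and
-- x * y ≤ y, and since c ⇒ 𝟘 = ∼ c = c we get c * c = 𝟘, so c annihilates
-- everything below c.  For (1), expanding (x ∨ c) * (y ∨ c) leaves x * y plus
-- terms below c, which vanish in the join with c.  For (2), ∼(∼ y ∨ c) = y ∧ c,
-- so the c-summand of x ∨ c dies and the two conjuncts become
-- ∼ (x * (y ∧ c)) ∧ ∼ ((x ∧ c) * y), which the Leibniz condition and the de Morgan
-- law for ∼ turn into ∼ ((x * y) ∧ c) = ∼ (x * y) ∨ c.
module Submission where

open import Defs
open import Level using (Level)
open import Relation.Binary.PropositionalEquality using (_≡_; sym; trans; cong; cong₂; module ≡-Reasoning)
open import Data.Product using (_×_; _,_)
open import Function using (Equivalence)
open import Algebra.Structures using (IsCommutativeMonoid)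
import Algebra.Lattice.Properties.Lattice as LatticeProperties
import Relation.Binary.Lattice as OrderTheoretic
import Relation.Binary.Lattice.Properties.JoinSemilattice as JoinSemilatticeProperties
import Relation.Binary.Reasoning.PartialOrder as ≤-Reasoning

module DRLAlgebraProperties {a : Level} (A : DRLAlgebra a) where

  open DRLAlgebra A hiding (_≤_)
  open IsCommutativeMonoid isCommutativeMonoid using () renaming (comm to *-comm; identityˡ to *-identityˡ; identityʳ to *-identityʳ)

  -- The order used from here on is the library's natural order x ≡ x ∧ y; the
  -- fields bottom, top and residuation state DRLAlgebra._≤_, i.e. x ∧ y ≡ x.
  orderLattice : OrderTheoretic.Lattice a a a
  orderLattice = LatticeProperties.∨-∧-orderTheoreticLattice (record { isLattice = isLattice })

  open OrderTheoretic.Lattice orderLattice using (_≤_; poset; x≤x∨y; y≤x∨y; ∨-least; x∧y≤y; antisym)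
    renaming (refl to ≤-refl; reflexive to ≤-reflexive; trans to ≤-trans)
  open JoinSemilatticeProperties (OrderTheoretic.Lattice.joinSemilattice orderLattice) using (x≤y⇒x∨y≈y; ∨-comm; ∨-assoc)

  𝟘≤ : ∀ x → 𝟘 ≤ x
  𝟘≤ x = sym (bottom x)

  ≤𝟙 : ∀ x → x ≤ 𝟙
  ≤𝟙 x = sym (top x)

  ≤𝟘⇒≡𝟘 : ∀ {x} → x ≤ 𝟘 → x ≡ 𝟘
  ≤𝟘⇒≡𝟘 {x} x≤𝟘 = antisym x≤𝟘 (𝟘≤ x)

  transpose-⇒ : ∀ {x y z} → x * y ≤ z → x ≤ y ⇒ z
  transpose-⇒ {x} {y} {z} xy≤z = sym (Equivalence.to (residuation x y z) (sym xy≤z))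

  transpose-* : ∀ {x y z} → x ≤ y ⇒ z → x * y ≤ z
  transpose-* {x} {y} {z} x≤y⇒z = sym (Equivalence.from (residuation x y z) (sym x≤y⇒z))

  *-monoˡ-≤ : ∀ {x y} z → x ≤ y → x * z ≤ y * z
  *-monoˡ-≤ z x≤y = transpose-* (≤-trans x≤y (transpose-⇒ ≤-refl))

  *-monoʳ-≤ : ∀ {x y} z → x ≤ y → z * x ≤ z * y
  *-monoʳ-≤ {x} {y} z x≤y rewrite *-comm z x | *-comm z y = *-monoˡ-≤ z x≤y

  *-distribʳ-∨ : ∀ x y z → (x ∨ y) * z ≡ x * z ∨ y * z
  *-distribʳ-∨ x y z = antisym
    (transpose-* (∨-least (transpose-⇒ (x≤x∨y _ _)) (transpose-⇒ (y≤x∨y _ _))))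
    (∨-least (*-monoˡ-≤ z (x≤x∨y x y)) (*-monoˡ-≤ z (y≤x∨y x y)))

  *-distribˡ-∨ : ∀ x y z → x * (y ∨ z) ≡ x * y ∨ x * z
  *-distribˡ-∨ x y z = begin
    x * (y ∨ z)      ≡⟨ *-comm x _ ⟩
    (y ∨ z) * x      ≡⟨ *-distribʳ-∨ y z x ⟩
    y * x ∨ z * x    ≡⟨ cong₂ _∨_ (*-comm y x) (*-comm z x) ⟩
    x * y ∨ x * z    ∎
    where open ≡-Reasoning

  x*y≤y : ∀ x y → x * y ≤ y
  x*y≤y x y = begin
    x * y   ≤⟨ *-monoˡ-≤ y (≤𝟙 x) ⟩
    𝟙 * y   ≡⟨ *-identityˡ y ⟩
    y       ∎
    where open ≤-Reasoning poset

  x*y≤x : ∀ x y → x * y ≤ x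
  x*y≤x x y rewrite *-comm x y = x*y≤y y x

  ∼𝟘≡𝟙 : ∼ 𝟘 ≡ 𝟙
  ∼𝟘≡𝟙 = begin
    ∼ 𝟘             ≡⟨ cong ∼_ (𝟘≤ (∼ 𝟙)) ⟩
    ∼ (𝟘 ∧ ∼ 𝟙)     ≡⟨ ∼-∧ 𝟘 (∼ 𝟙) ⟩
    ∼ 𝟘 ∨ ∼ (∼ 𝟙)   ≡⟨ cong (∼ 𝟘 ∨_) (∼-involutive 𝟙) ⟩
    ∼ 𝟘 ∨ 𝟙         ≡⟨ x≤y⇒x∨y≈y (≤𝟙 (∼ 𝟘)) ⟩
    𝟙               ∎
    where open ≡-Reasoning

  c⇒𝟘≡c : c ⇒ 𝟘 ≡ c
  c⇒𝟘≡c = begin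
    ∼ (c * ∼ 𝟘)   ≡⟨ cong (λ t → ∼ (c * t)) ∼𝟘≡𝟙 ⟩
    ∼ (c * 𝟙)     ≡⟨ cong ∼_ (*-identityʳ c) ⟩
    ∼ c           ≡⟨ ∼-c ⟩
    c             ∎
    where open ≡-Reasoning

  c*c≡𝟘 : c * c ≡ 𝟘
  c*c≡𝟘 = ≤𝟘⇒≡𝟘 (transpose-* (≤-reflexive (sym c⇒𝟘≡c)))

  ≤c⇒c*x≡𝟘 : ∀ {x} → x ≤ c → c * x ≡ 𝟘
  ≤c⇒c*x≡𝟘 x≤c = ≤𝟘⇒≡𝟘 (≤-trans (*-monoʳ-≤ c x≤c) (≤-reflexive c*c≡𝟘))

  ≤c⇒[y∨x]∨c≡y∨c : ∀ {x} y → x ≤ c → (y ∨ x) ∨ c ≡ y ∨ c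
  ≤c⇒[y∨x]∨c≡y∨c {x} y x≤c = trans (∨-assoc y x c) (cong (y ∨_) (x≤y⇒x∨y≈y x≤c))

  ∨-identityʳ : ∀ x → x ∨ 𝟘 ≡ x
  ∨-identityʳ x = trans (∨-comm x 𝟘) (x≤y⇒x∨y≈y (𝟘≤ x))

  [x∨c]*[y∨c]∨c≡x*y∨c : ∀ x y → (x ∨ c) * (y ∨ c) ∨ c ≡ x * y ∨ c
  [x∨c]*[y∨c]∨c≡x*y∨c x y = begin
    (x ∨ c) * (y ∨ c) ∨ c              ≡⟨ cong (_∨ c) (*-distribʳ-∨ x c (y ∨ c)) ⟩
    (x * (y ∨ c) ∨ c * (y ∨ c)) ∨ c    ≡⟨ ≤c⇒[y∨x]∨c≡y∨c _ (x*y≤x c (y ∨ c)) ⟩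
    x * (y ∨ c) ∨ c                    ≡⟨ cong (_∨ c) (*-distribˡ-∨ x y c) ⟩
    (x * y ∨ x * c) ∨ c                ≡⟨ ≤c⇒[y∨x]∨c≡y∨c _ (x*y≤y x c) ⟩
    x * y ∨ c                          ∎
    where open ≡-Reasoning

  [x∨c]*[y∧c]≡x*[y∧c] : ∀ x y → (x ∨ c) * (y ∧ c) ≡ x * (y ∧ c)
  [x∨c]*[y∧c]≡x*[y∧c] x y = begin
    (x ∨ c) * (y ∧ c)              ≡⟨ *-distribʳ-∨ x c (y ∧ c) ⟩
    x * (y ∧ c) ∨ c * (y ∧ c)      ≡⟨ cong (x * (y ∧ c) ∨_) (≤c⇒c*x≡𝟘 (x∧y≤y y c)) ⟩
    x * (y ∧ c) ∨ 𝟘                ≡⟨ ∨-identityʳ _ ⟩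
    x * (y ∧ c)                    ∎
    where open ≡-Reasoning

  ∼[∼x∨c]≡x∧c : ∀ x → ∼ (∼ x ∨ c) ≡ x ∧ c
  ∼[∼x∨c]≡x∧c x = trans (∼-∨ (∼ x) c) (cong₂ _∧_ (∼-involutive x) ∼-c)

  ∼[[x∨c]*∼[∼y∨c]]∧∼[[y∨c]*∼[∼x∨c]]≡∼[x*y]∨c : ∀ x y →
    ∼ ((x ∨ c) * ∼ (∼ y ∨ c)) ∧ ∼ ((y ∨ c) * ∼ (∼ x ∨ c)) ≡ ∼ (x * y) ∨ c
  ∼[[x∨c]*∼[∼y∨c]]∧∼[[y∨c]*∼[∼x∨c]]≡∼[x*y]∨c x y = begin
    ∼ ((x ∨ c) * ∼ (∼ y ∨ c)) ∧ ∼ ((y ∨ c) * ∼ (∼ x ∨ c))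
      ≡⟨ cong₂ (λ u v → ∼ ((x ∨ c) * u) ∧ ∼ ((y ∨ c) * v)) (∼[∼x∨c]≡x∧c y) (∼[∼x∨c]≡x∧c x) ⟩
    ∼ ((x ∨ c) * (y ∧ c)) ∧ ∼ ((y ∨ c) * (x ∧ c))
      ≡⟨ cong₂ (λ u v → ∼ u ∧ ∼ v) ([x∨c]*[y∧c]≡x*[y∧c] x y) ([x∨c]*[y∧c]≡x*[y∧c] y x) ⟩
    ∼ (x * (y ∧ c)) ∧ ∼ (y * (x ∧ c))
      ≡⟨ cong (λ u → ∼ (x * (y ∧ c)) ∧ ∼ u) (*-comm y (x ∧ c)) ⟩
    ∼ (x * (y ∧ c)) ∧ ∼ ((x ∧ c) * y)   ≡⟨ sym (∼-∨ _ _) ⟩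
    ∼ (x * (y ∧ c) ∨ (x ∧ c) * y)       ≡⟨ cong ∼_ (∨-comm _ _) ⟩
    ∼ ((x ∧ c) * y ∨ x * (y ∧ c))       ≡⟨ cong ∼_ (sym (leibniz x y)) ⟩
    ∼ (x * y ∧ c)                       ≡⟨ ∼-∧ _ _ ⟩
    ∼ (x * y) ∨ ∼ c                     ≡⟨ cong (∼ (x * y) ∨_) ∼-c ⟩
    ∼ (x * y) ∨ c                       ∎
    where open ≡-Reasoning

mainTheorem6 : ∀ {a : Level} (A : DRLAlgebra a) → let open DRLAlgebra A in ∀ x y → ((((x ∨ c) * (y ∨ c)) ∨ c ≡ (x * y) ∨ c) × ((∼ ((x ∨ c) * (∼ ((∼ y) ∨ c)))) ∧ (∼ ((y ∨ c) * (∼ ((∼ x) ∨ c)))) ≡ (∼ (x * y)) ∨ c))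
mainTheorem6 A x y =
  [x∨c]*[y∨c]∨c≡x*y∨c x y , ∼[[x∨c]*∼[∼y∨c]]∧∼[[y∨c]*∼[∼x∨c]]≡∼[x*y]∨c x y
  where open DRLAlgebraProperties A
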